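{- Let $V$ be a finite set and let $\mathcal{P}$, $\mathcal{P}'$ be partitions of $V$ into nonempty parts, with $\vert\mathcal{P}\vert\ge 2$, and let $P_i', P_j' \in \mathcal{P}'$ be distinct. Define, for $\mathcal{S} \subseteq \mathcal{P}$, \[ \phi^*_{i',j'}(\mathcal{S}) := \vert U_{\mathcal{S}} \cap P_j' \vert + \vert P_i' \vert - \vert U_{\mathcal{S}} \cap P_i' \vert + \sum_{P' \in \mathcal{P}' \setminus \{P_i', P_j'\}} \vert P' \vert \operatorname{peak}\!\left(\frac{\vert U_{\mathcal{S}} \cap P' \vert}{\vert P' \vert}\right), \] where $\operatorname{peak}(x) = x$ for $x \le 1/2$ and $1-x$ for $x > 1/2$. Let $\mathcal{S}$ minimize $\phi^*_{i',j'}$ over all $\emptyset \neq \mathcal{S} \subsetneq \mathcal{P}$, and set $\mathcal{S}' := \{P_i'\} \cup \{P' \in \mathcal{P}' \setminus \{P_i', P_j'\} : \vert U_{\mathcal{S}} \cap P' \vert > \vert P' \vert / 2\}$. Then $(\mathcal{S}, \mathcal{S}')$ is an optimal $C_{\wedge}$-correspondence under the constraint $P_i' \in \mathcal{S}'$ and $P_j' \notin \mathcal{S}'$; that is, $\vert U_{\mathcal{S}} \triangle U_{\mathcal{S}'}\vert \le \vert U_{\mathcal{T}} \triangle U_{\mathcal{T}'}\vert$ for all $\emptyset\ne\mathcal{T}\subsetneq\mathcal{P}$ and $\mathcal{T}'\subseteq\mathcal{P}'$ with $P_i'\in\mathcal{T}'$, $P_j'\notin\mathcal{T}'$.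
   Context: $U_{\mathcal{S}}$ denotes the union of the members of $\mathcal{S}$; $\triangle$ is symmetric difference; $\vert\cdot\vert$ is cardinality (or total weight, if elements carry positive weights). A $C_{\wedge}$-correspondence is a pair $(\mathcal{S},\mathcal{S}')$ with $\mathcal{S}\subseteq\mathcal{P}$, $\mathcal{S}'\subseteq\mathcal{P}'$, $\mathcal{S}\notin\{\emptyset,\mathcal{P}\}$ and $\mathcal{S}'\notin\{\emptyset,\mathcal{P}'\}$; the constraint $P_i'\in\mathcal{S}'$, $P_j'\notin\mathcal{S}'$ forces the latter condition. -}

module Defs where

open import Data.Bool using (Bool; true; false; if_then_else_; not; _∧_; _∨_)
open import Data.Nat as ℕ using (ℕ; zero; suc)
open import Data.Integer using (+_)
open import Data.Rational as ℚ using (ℚ; 0ℚ; 1ℚ; ½; _≤ᵇ_)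
open import Data.Fin using (Fin; _≟_)
open import Data.Fin.Subset using (Subset; _∩_; _∪_; _─_; ∣_∣)
open import Data.Vec using (tabulate; lookup)
open import Data.List using (List; foldr; filterᵇ; allFin)
open import Data.Product using (∃)
open import Relation.Binary.PropositionalEquality using (_≡_)
open import Relation.Nullary.Decidable using (⌊_⌋)

-- Ground set V = Fin n.  A partition of V into k nonempty parts is a
-- labelling  p : Fin n → Fin k  that is surjective (every part nonempty);
-- part c is the block  { v | p v ≡ c }.
Surjective : {n k : ℕ} → (Fin n → Fin k) → Set
Surjective {n} {k} p = (c : Fin k) → ∃ λ v → p v ≡ c

block : {n k : ℕ} → (Fin n → Fin k) → Fin k → Subset n
block p c = tabulate (λ v → ⌊ p v ≟ c ⌋)

U : {n k : ℕ} → (Fin n → Fin k) → Subset k → Subset n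
U p S = tabulate (λ v → lookup S (p v))

_△_ : {n : ℕ} → Subset n → Subset n → Subset n
A △ B = (A ─ B) ∪ (B ─ A)

ℕ→ℚ : ℕ → ℚ
ℕ→ℚ a = + a ℚ./ 1

-- a / b as a rational (b is always nonzero where used; 0 otherwise)
ratio : ℕ → ℕ → ℚ
ratio a zero = 0ℚ
ratio a (suc b) = + a ℚ./ suc b

peak : ℚ → ℚ
peak x = if x ≤ᵇ ½ then x else 1ℚ ℚ.- x

sumℚ : {m : ℕ} → (Fin m → Bool) → (Fin m → ℚ) → ℚ
sumℚ {m} keep f = foldr (λ c acc → f c ℚ.+ acc) 0ℚ (filterᵇ keep (allFin m))

notIJ : {m : ℕ} → Fin m → Fin m → Fin m → Bool
notIJ i j c = not ⌊ c ≟ i ⌋ ∧ not ⌊ c ≟ j ⌋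

phi* : {n k m : ℕ} → (Fin n → Fin k) → (Fin n → Fin m) → Fin m → Fin m →
       Subset k → ℚ
phi* p q i j S =
  ℕ→ℚ (∣ US ∩ block q j ∣)
  ℚ.+ (ℕ→ℚ (∣ block q i ∣) ℚ.- ℕ→ℚ (∣ US ∩ block q i ∣))
  ℚ.+ sumℚ (notIJ i j)
        (λ c → ℕ→ℚ (∣ block q c ∣)
               ℚ.* peak (ratio (∣ US ∩ block q c ∣) (∣ block q c ∣)))
  where US = U p S

S'-of : {n k m : ℕ} → (Fin n → Fin k) → (Fin n → Fin m) → Fin m → Fin m →
        Subset k → Subset m
S'-of p q i j S = tabulate (λ c →
  ⌊ c ≟ i ⌋ ∨ (notIJ i j c ∧
     (ℕ.suc (∣ block q c ∣) ℕ.≤ᵇ 2 ℕ.* (∣ U p S ∩ block q c ∣))))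

-- Split U_S △ U_S' along the parts of 𝒫'. A part P' meeting U_S in a of its b vertices
-- contributes b − a to the symmetric difference if P' ∈ S' and a otherwise. So for fixed S
-- the best S' containing P_i' but not P_j' puts every other part on its majority side, each
-- such part then contributing min(a, b − a) = b · peak(a/b); the cost of that best S' is
-- exactly φ*(S). Hence cost(S, S') = φ*(S) ≤ φ*(T) = cost(T, T'') ≤ cost(T, T'), where T''
-- is the majority choice for T.
module Submission where

open import Defs
open import Algebra.Bundles using (Monoid)
import Algebra.Properties.Monoid.Sum as MonoidSum
import Algebra.Properties.CommutativeMonoid.Sum as CommutativeMonoidSum
open import Data.Bool using (Bool; true; false; not; _∧_; _∨_; if_then_else_)
open import Data.Empty using (⊥-elim)
open import Data.Fin using (Fin; zero; suc; _≟_)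
open import Data.Fin.Properties using (suc-injective)
open import Data.Fin.Subset using (Subset; Nonempty; ∁; _∩_; ∣_∣)
open import Data.Fin.Subset.Properties using (∩-comm; ∣p∩q∣≤∣q∣)
open import Data.Integer as ℤ using (+_)
import Data.Integer.Properties as ℤ
open import Data.Integer.Tactic.RingSolver renaming (solve-∀ to ℤ-solve-∀)
open import Data.List using (foldr; filterᵇ)
import Data.List as List
open import Data.Nat using (ℕ; zero; suc; z≤n; _+_; _*_; _∸_; _≤_; _≤ᵇ_)
open import Data.Nat.Properties as ℕ using (≤-refl; +-suc; m+n∸n≡m)
open import Data.Nat.Tactic.RingSolver renaming (solve-∀ to ℕ-solve-∀)
open import Data.Rational as ℚ using (ℚ; 0ℚ; 1ℚ; ½; toℚᵘ) renaming (_≤_ to _≤ℚ_)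
import Data.Rational.Properties as ℚ
open import Data.Rational.Properties
  using (toℚᵘ-injective; toℚᵘ-fromℚᵘ; toℚᵘ-homo-+; toℚᵘ-homo-*; toℚᵘ-mono-≤; toℚᵘ-cancel-≤)
open import Data.Rational.Unnormalised as ℚᵘ using (ℚᵘ; mkℚᵘ; *≡*; *≤*) renaming (_≃_ to _≃ᵘ_)
import Data.Rational.Unnormalised.Properties as ℚᵘ
open import Data.Vec using ([]; _∷_; lookup)
open import Data.Vec.Properties using (lookup∘tabulate)
open import Function using (_∘_; id)
open import Function.Bundles using (_⇔_; mk⇔; Equivalence)
open import Relation.Binary.PropositionalEquality
open import Relation.Nullary.Decidable using (Dec; ⌊_⌋; yes; no; T?; dec-true; dec-false)
open import Relation.Nullary.Negation using (¬_)
open import Relation.Nullary.Reflects using (ofʸ; ofⁿ)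

⌊x≟x⌋ : ∀ {m} (x : Fin m) → ⌊ x ≟ x ⌋ ≡ true
⌊x≟x⌋ x = cong ⌊_⌋ (≡-≟-identity _≟_ refl)

module _ {c ℓ} (M : Monoid c ℓ) where
  open Monoid M
    using (Carrier; _≈_; ε; ∙-congˡ; ∙-congʳ; identityˡ; identityʳ; reflexive) renaming (trans to ≈-trans)
  open MonoidSum M

  ∑-pointMass : ∀ {m} (x : Fin m) (f : Fin m → Carrier) →
                (∀ y → y ≢ x → f y ≈ ε) → ∑[ y < m ] f y ≈ f x
  ∑-pointMass {suc m} zero f f≈ε = ≈-trans
    (∙-congˡ (≈-trans (sum-cong-≋ (λ y → f≈ε (suc y) λ ())) (sum-replicate-zero m)))
    (identityʳ (f zero))
  ∑-pointMass {suc m} (suc x) f f≈ε = ≈-trans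
    (∙-congʳ (f≈ε zero λ ()))
    (≈-trans (identityˡ _) (∑-pointMass x (f ∘ suc) (λ y y≢x → f≈ε (suc y) (y≢x ∘ suc-injective))))

  ∑-indicator : ∀ {m} (x : Fin m) (a : Carrier) → ∑[ y < m ] (if ⌊ y ≟ x ⌋ then a else ε) ≈ a
  ∑-indicator x a = ≈-trans
    (∑-pointMass x _ (λ y y≢x → reflexive (cong (λ t → if t then a else ε) (cong ⌊_⌋ (≢-≟-identity _≟_ y≢x)))))
    (reflexive (cong (λ t → if t then a else ε) (⌊x≟x⌋ x)))

module ℕΣ = CommutativeMonoidSum ℕ.+-0-commutativeMonoid

∣∷∣ : ∀ {n} b (A : Subset n) → ∣ b ∷ A ∣ ≡ ∣ b ∷ [] ∣ + ∣ A ∣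
∣∷∣ false A = refl
∣∷∣ true  A = refl

∣A∣≡∑∣block∩A∣ : ∀ {n m} (q : Fin n → Fin m) (A : Subset n) →
                 ∣ A ∣ ≡ ℕΣ.∑[ c < m ] ∣ block q c ∩ A ∣
∣A∣≡∑∣block∩A∣ {m = m} q [] = sym (ℕΣ.sum-replicate-zero m)
∣A∣≡∑∣block∩A∣ {m = m} q (a ∷ A) = begin
  ∣ a ∷ A ∣                                                     ≡⟨ ∣∷∣ a A ⟩
  ∣ a ∷ [] ∣ + ∣ A ∣                                            ≡⟨ cong₂ _+_ (sym first) (∣A∣≡∑∣block∩A∣ (q ∘ suc) A) ⟩
  ℕΣ.sum (λ c → ∣ (⌊ q zero ≟ c ⌋ ∧ a) ∷ [] ∣) + ℕΣ.sum (λ c → ∣ block (q ∘ suc) c ∩ A ∣)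
                                                                ≡⟨ ℕΣ.∑-distrib-+ {m} _ _ ⟨
  ℕΣ.sum (λ c → ∣ (⌊ q zero ≟ c ⌋ ∧ a) ∷ [] ∣ + ∣ block (q ∘ suc) c ∩ A ∣)
                                                                ≡⟨ ℕΣ.sum-cong-≗ {m} (λ c → ∣∷∣ (⌊ q zero ≟ c ⌋ ∧ a) (block (q ∘ suc) c ∩ A)) ⟨
  ℕΣ.sum (λ c → ∣ block q c ∩ (a ∷ A) ∣)                        ∎
  where
  open ≡-Reasoning
  first : ℕΣ.sum (λ c → ∣ (⌊ q zero ≟ c ⌋ ∧ a) ∷ [] ∣) ≡ ∣ a ∷ [] ∣
  first = trans (∑-pointMass ℕ.+-0-monoid (q zero) _
                  (λ c c≢q₀ → cong (λ t → ∣ (t ∧ a) ∷ [] ∣) (cong ⌊_⌋ (≢-≟-identity _≟_ (c≢q₀ ∘ sym)))))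
                (cong (λ t → ∣ (t ∧ a) ∷ [] ∣) (⌊x≟x⌋ (q zero)))

∣K∩[A△B]∣+∣K∩A∣≡∣K∣ : ∀ {n} (A B K : Subset n) → (∀ v → lookup K v ≡ true → lookup B v ≡ true) →
                      ∣ K ∩ (A △ B) ∣ + ∣ K ∩ A ∣ ≡ ∣ K ∣
∣K∩[A△B]∣+∣K∩A∣≡∣K∣ []          []          []          K⊆B = refl
∣K∩[A△B]∣+∣K∩A∣≡∣K∣ (_ ∷ A)     (_ ∷ B)     (false ∷ K) K⊆B = ∣K∩[A△B]∣+∣K∩A∣≡∣K∣ A B K (K⊆B ∘ suc)
∣K∩[A△B]∣+∣K∩A∣≡∣K∣ (true ∷ A)  (true ∷ B)  (true ∷ K)  K⊆B =
  trans (+-suc _ _) (cong suc (∣K∩[A△B]∣+∣K∩A∣≡∣K∣ A B K (K⊆B ∘ suc)))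
∣K∩[A△B]∣+∣K∩A∣≡∣K∣ (false ∷ A) (true ∷ B)  (true ∷ K)  K⊆B =
  cong suc (∣K∩[A△B]∣+∣K∩A∣≡∣K∣ A B K (K⊆B ∘ suc))
∣K∩[A△B]∣+∣K∩A∣≡∣K∣ (_ ∷ A)     (false ∷ B) (true ∷ K)  K⊆B with K⊆B zero refl
... | ()

K∩[A△B]≡K∩A : ∀ {n} (A B K : Subset n) → (∀ v → lookup K v ≡ true → lookup B v ≡ false) →
               K ∩ (A △ B) ≡ K ∩ A
K∩[A△B]≡K∩A []          []          []          K∩B≡∅ = refl
K∩[A△B]≡K∩A (_ ∷ A)     (_ ∷ B)     (false ∷ K) K∩B≡∅ = cong (false ∷_) (K∩[A△B]≡K∩A A B K (K∩B≡∅ ∘ suc))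
K∩[A△B]≡K∩A (true ∷ A)  (false ∷ B) (true ∷ K)  K∩B≡∅ = cong (true ∷_) (K∩[A△B]≡K∩A A B K (K∩B≡∅ ∘ suc))
K∩[A△B]≡K∩A (false ∷ A) (false ∷ B) (true ∷ K)  K∩B≡∅ = cong (false ∷_) (K∩[A△B]≡K∩A A B K (K∩B≡∅ ∘ suc))
K∩[A△B]≡K∩A (_ ∷ A)     (true ∷ B)  (true ∷ K)  K∩B≡∅ with K∩B≡∅ zero refl
... | ()

-- The number of vertices of a part with b vertices, a of them in U, that lie in U △ U_S'
-- when the part belongs to S' exactly if t holds.
misplaced : Bool → ℕ → ℕ → ℕ
misplaced t a b = if t then b ∸ a else a

U-constant-on-block : ∀ {n m} (q : Fin n → Fin m) (T' : Subset m) (c : Fin m) v →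
                      lookup (block q c) v ≡ true → lookup (U q T') v ≡ lookup T' c
U-constant-on-block q T' c v v∈P
  rewrite lookup∘tabulate (λ v → ⌊ q v ≟ c ⌋) v | lookup∘tabulate (lookup T' ∘ q) v
  with q v ≟ c | v∈P
... | yes refl | _  = refl
... | no _     | ()

∣block∩[A△U]∣ : ∀ {n m} (q : Fin n → Fin m) (A : Subset n) (T' : Subset m) (c : Fin m) →
                ∣ block q c ∩ (A △ U q T') ∣ ≡ misplaced (lookup T' c) ∣ A ∩ block q c ∣ ∣ block q c ∣
∣block∩[A△U]∣ q A T' c with lookup T' c | U-constant-on-block q T' c
... | true  | P⊆U = begin
  ∣ P ∩ (A △ U q T') ∣                               ≡⟨ m+n∸n≡m _ ∣ P ∩ A ∣ ⟨
  ∣ P ∩ (A △ U q T') ∣ + ∣ P ∩ A ∣ ∸ ∣ P ∩ A ∣       ≡⟨ cong (_∸ ∣ P ∩ A ∣) (∣K∩[A△B]∣+∣K∩A∣≡∣K∣ A (U q T') P P⊆U) ⟩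
  ∣ P ∣ ∸ ∣ P ∩ A ∣                                   ≡⟨ cong (λ S → ∣ P ∣ ∸ ∣ S ∣) (∩-comm P A) ⟩
  ∣ P ∣ ∸ ∣ A ∩ P ∣                                   ∎
  where open ≡-Reasoning; P = block q c
... | false | P∩U≡∅ = cong ∣_∣ (trans (K∩[A△B]≡K∩A A (U q T') (block q c) P∩U≡∅) (∩-comm (block q c) A))

∣A△U∣≡∑misplaced : ∀ {n m} (q : Fin n → Fin m) (A : Subset n) (T' : Subset m) →
                   ∣ A △ U q T' ∣ ≡ ℕΣ.∑[ c < m ] misplaced (lookup T' c) ∣ A ∩ block q c ∣ ∣ block q c ∣
∣A△U∣≡∑misplaced {m = m} q A T' =
  trans (∣A∣≡∑∣block∩A∣ q (A △ U q T')) (ℕΣ.sum-cong-≗ {m} (∣block∩[A△U]∣ q A T'))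

misplaced-by-majority-≤ : ∀ t a b → misplaced (suc b ≤ᵇ 2 * a) a b ≤ misplaced t a b
misplaced-by-majority-≤ t a b rewrite ℕ.+-identityʳ a
  with suc b ≤ᵇ a + a | ℕ.≤ᵇ-reflects-≤ (suc b) (a + a) | t
... | true  | ofʸ b<2a | true  = ≤-refl
... | true  | ofʸ b<2a | false = ℕ.m≤n+o⇒m∸n≤o b a (ℕ.<⇒≤ b<2a)
... | false | ofⁿ b≮2a | true  = ℕ.m+n≤o⇒m≤o∸n a (ℕ.≮⇒≥ b≮2a)
... | false | ofⁿ b≮2a | false = ≤-refl

∑-mono-≤ : ∀ {m} {f g : Fin m → ℕ} → (∀ c → f c ≤ g c) → ℕΣ.∑[ c < m ] f c ≤ ℕΣ.∑[ c < m ] g c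
∑-mono-≤ {zero}  f≤g = z≤n
∑-mono-≤ {suc m} f≤g = ℕ.+-mono-≤ (f≤g zero) (∑-mono-≤ (f≤g ∘ suc))


ℕᵘ : ℕ → ℚᵘ
ℕᵘ a = mkℚᵘ (+ a) 0

toℚᵘ-ℕ→ℚ : ∀ a → toℚᵘ (ℕ→ℚ a) ≃ᵘ ℕᵘ a
toℚᵘ-ℕ→ℚ a = toℚᵘ-fromℚᵘ (ℕᵘ a)

toℚᵘ-ratio : ∀ a b → toℚᵘ (ratio a (suc b)) ≃ᵘ mkℚᵘ (+ a) b
toℚᵘ-ratio a b = toℚᵘ-fromℚᵘ (mkℚᵘ (+ a) b)

ℕ→ℚ-+ : ∀ a b → ℕ→ℚ (a + b) ≡ ℕ→ℚ a ℚ.+ ℕ→ℚ b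
ℕ→ℚ-+ a b = toℚᵘ-injective (begin
  toℚᵘ (ℕ→ℚ (a + b))                 ≈⟨ toℚᵘ-ℕ→ℚ (a + b) ⟩
  ℕᵘ (a + b)                          ≈⟨ *≡* (trans (cong (ℤ._* + 1) (ℤ.pos-+ a b)) (identity (+ a) (+ b))) ⟩
  ℕᵘ a ℚᵘ.+ ℕᵘ b                      ≈⟨ ℚᵘ.+-cong (toℚᵘ-ℕ→ℚ a) (toℚᵘ-ℕ→ℚ b) ⟨
  toℚᵘ (ℕ→ℚ a) ℚᵘ.+ toℚᵘ (ℕ→ℚ b)     ≈⟨ toℚᵘ-homo-+ (ℕ→ℚ a) (ℕ→ℚ b) ⟨
  toℚᵘ (ℕ→ℚ a ℚ.+ ℕ→ℚ b)             ∎)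
  where
  open ℚᵘ.≃-Reasoning
  identity : ∀ x y → (x ℤ.+ y) ℤ.* + 1 ≡ (x ℤ.* + 1 ℤ.+ y ℤ.* + 1) ℤ.* + 1
  identity = ℤ-solve-∀

ℕ→ℚ-∸ : ∀ {a b} → b ≤ a → ℕ→ℚ (a ∸ b) ≡ ℕ→ℚ a ℚ.- ℕ→ℚ b
ℕ→ℚ-∸ {a} {b} b≤a = begin
  ℕ→ℚ (a ∸ b)                                 ≡⟨ ℚ.+-identityʳ (ℕ→ℚ (a ∸ b)) ⟨
  ℕ→ℚ (a ∸ b) ℚ.+ 0ℚ                          ≡⟨ cong (ℕ→ℚ (a ∸ b) ℚ.+_) (ℚ.+-inverseʳ (ℕ→ℚ b)) ⟨
  ℕ→ℚ (a ∸ b) ℚ.+ (ℕ→ℚ b ℚ.- ℕ→ℚ b)           ≡⟨ ℚ.+-assoc (ℕ→ℚ (a ∸ b)) (ℕ→ℚ b) (ℚ.- ℕ→ℚ b) ⟨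
  (ℕ→ℚ (a ∸ b) ℚ.+ ℕ→ℚ b) ℚ.- ℕ→ℚ b           ≡⟨ cong (ℚ._- ℕ→ℚ b) (ℕ→ℚ-+ (a ∸ b) b) ⟨
  ℕ→ℚ (a ∸ b + b) ℚ.- ℕ→ℚ b                   ≡⟨ cong (λ x → ℕ→ℚ x ℚ.- ℕ→ℚ b) (ℕ.m∸n+n≡m b≤a) ⟩
  ℕ→ℚ a ℚ.- ℕ→ℚ b                             ∎
  where open ≡-Reasoning

ℕ→ℚ-cancel-≤ : ∀ {a b} → ℕ→ℚ a ≤ℚ ℕ→ℚ b → a ≤ b
ℕ→ℚ-cancel-≤ {a} {b} a≤b
  with ℚᵘ.≤-respˡ-≃ (toℚᵘ-ℕ→ℚ a) (ℚᵘ.≤-respʳ-≃ (toℚᵘ-ℕ→ℚ b) (toℚᵘ-mono-≤ a≤b))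
... | *≤* a*1≤b*1 = ℤ.drop‿+≤+ (subst₂ ℤ._≤_ (ℤ.*-identityʳ (+ a)) (ℤ.*-identityʳ (+ b)) a*1≤b*1)

module ℚΣ = CommutativeMonoidSum ℚ.+-0-commutativeMonoid

ℕ→ℚ-∑ : ∀ {m} (f : Fin m → ℕ) → ℕ→ℚ (ℕΣ.∑[ c < m ] f c) ≡ ℚΣ.∑[ c < m ] ℕ→ℚ (f c)
ℕ→ℚ-∑ {zero}  f = refl
ℕ→ℚ-∑ {suc m} f = trans (ℕ→ℚ-+ (f zero) _) (cong (ℕ→ℚ (f zero) ℚ.+_) (ℕ→ℚ-∑ (f ∘ suc)))

ℕ→ℚ-*-ratio : ∀ a b → ℕ→ℚ (suc b) ℚ.* ratio a (suc b) ≡ ℕ→ℚ a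
ℕ→ℚ-*-ratio a b = toℚᵘ-injective (begin
  toℚᵘ (ℕ→ℚ (suc b) ℚ.* ratio a (suc b))            ≈⟨ toℚᵘ-homo-* (ℕ→ℚ (suc b)) (ratio a (suc b)) ⟩
  toℚᵘ (ℕ→ℚ (suc b)) ℚᵘ.* toℚᵘ (ratio a (suc b))    ≈⟨ ℚᵘ.*-cong (toℚᵘ-ℕ→ℚ (suc b)) (toℚᵘ-ratio a b) ⟩
  ℕᵘ (suc b) ℚᵘ.* mkℚᵘ (+ a) b                      ≈⟨ *≡* cross-multiplied ⟨
  ℕᵘ a                                              ≈⟨ toℚᵘ-ℕ→ℚ a ⟨
  toℚᵘ (ℕ→ℚ a)                                      ∎)
  where
  open ℚᵘ.≃-Reasoning
  identity : ∀ a b → a * suc (b + 0) ≡ suc b * a * 1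
  identity = ℕ-solve-∀
  cross-multiplied : + a ℤ.* + suc (b + 0) ≡ (+ suc b ℤ.* + a) ℤ.* + 1
  cross-multiplied = trans (sym (ℤ.pos-* a _)) (trans (cong +_ (identity a b))
    (trans (ℤ.pos-* (suc b * a) 1) (cong (ℤ._* + 1) (ℤ.pos-* (suc b) a))))

ratio≤½⇔ : ∀ a b → ratio a (suc b) ≤ℚ ½ ⇔ 2 * a ≤ suc b
ratio≤½⇔ a b = mk⇔
  (λ r≤½ → from-*≤* (ℚᵘ.≤-respˡ-≃ (toℚᵘ-ratio a b) (ℚᵘ.≤-respʳ-≃ toℚᵘ-½ (toℚᵘ-mono-≤ r≤½))))
  (λ 2a≤b → toℚᵘ-cancel-≤ (ℚᵘ.≤-respˡ-≃ (ℚᵘ.≃-sym (toℚᵘ-ratio a b)) (ℚᵘ.≤-respʳ-≃ (ℚᵘ.≃-sym toℚᵘ-½)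
     (*≤* (subst₂ ℤ._≤_ (sym a*2≡2*a) (sym (ℤ.*-identityˡ (+ suc b))) (ℤ.+≤+ 2a≤b))))))
  where
  toℚᵘ-½ : toℚᵘ ½ ≃ᵘ mkℚᵘ (+ 1) 1
  toℚᵘ-½ = toℚᵘ-fromℚᵘ (mkℚᵘ (+ 1) 1)
  a*2≡2*a : + a ℤ.* + 2 ≡ + (2 * a)
  a*2≡2*a = trans (sym (ℤ.pos-* a 2)) (cong +_ (ℕ.*-comm a 2))
  from-*≤* : mkℚᵘ (+ a) b ℚᵘ.≤ mkℚᵘ (+ 1) 1 → 2 * a ≤ suc b
  from-*≤* (*≤* a*2≤b) = ℤ.drop‿+≤+ (subst₂ ℤ._≤_ a*2≡2*a (ℤ.*-identityˡ (+ suc b)) a*2≤b)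

peak-≤½ : ∀ {x} → x ≤ℚ ½ → peak x ≡ x
peak-≤½ {x} x≤½ = cong (λ t → if t then x else 1ℚ ℚ.- x) (dec-true (T? (x ℚ.≤ᵇ ½)) (ℚ.≤⇒≤ᵇ x≤½))

peak-≰½ : ∀ {x} → ¬ x ≤ℚ ½ → peak x ≡ 1ℚ ℚ.- x
peak-≰½ {x} x≰½ = cong (λ t → if t then x else 1ℚ ℚ.- x) (dec-false (T? (x ℚ.≤ᵇ ½)) (x≰½ ∘ ℚ.≤ᵇ⇒≤))

peak-scaled : ∀ {a b} → a ≤ b → ℕ→ℚ b ℚ.* peak (ratio a b) ≡ ℕ→ℚ (misplaced (suc b ≤ᵇ 2 * a) a b)
-- For b = 0, where ratio returns 0, the hypothesis forces a = 0.
peak-scaled {b = zero} z≤n = ℚ.*-zeroˡ (peak 0ℚ)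
peak-scaled {a} {suc b} a≤b with suc (suc b) ≤ᵇ 2 * a | ℕ.≤ᵇ-reflects-≤ (suc (suc b)) (2 * a)
... | true  | ofʸ b<2a = begin
  ℕ→ℚ (suc b) ℚ.* peak r                       ≡⟨ cong (ℕ→ℚ (suc b) ℚ.*_) (peak-≰½ (ℕ.<⇒≱ b<2a ∘ Equivalence.to (ratio≤½⇔ a b))) ⟩
  ℕ→ℚ (suc b) ℚ.* (1ℚ ℚ.- r)                   ≡⟨ ℚ.*-distribˡ-+ (ℕ→ℚ (suc b)) 1ℚ (ℚ.- r) ⟩
  ℕ→ℚ (suc b) ℚ.* 1ℚ ℚ.+ ℕ→ℚ (suc b) ℚ.* ℚ.- r ≡⟨ cong₂ ℚ._+_ (ℚ.*-identityʳ (ℕ→ℚ (suc b))) (sym (ℚ.neg-distribʳ-* (ℕ→ℚ (suc b)) r)) ⟩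
  ℕ→ℚ (suc b) ℚ.- ℕ→ℚ (suc b) ℚ.* r           ≡⟨ cong (ℕ→ℚ (suc b) ℚ.+_) (cong ℚ.-_ (ℕ→ℚ-*-ratio a b)) ⟩
  ℕ→ℚ (suc b) ℚ.- ℕ→ℚ a                       ≡⟨ ℕ→ℚ-∸ a≤b ⟨
  ℕ→ℚ (suc b ∸ a)                              ∎
  where open ≡-Reasoning; r = ratio a (suc b)
... | false | ofⁿ b≮2a =
  trans (cong (ℕ→ℚ (suc b) ℚ.*_) (peak-≤½ (Equivalence.from (ratio≤½⇔ a b) (ℕ.≮⇒≥ b≮2a)))) (ℕ→ℚ-*-ratio a b)

foldr-filterᵇ-tabulate : ∀ {m} {A : Set} (g : Fin m → A) (keep : A → Bool) (f : A → ℚ) →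
  foldr (λ c acc → f c ℚ.+ acc) 0ℚ (filterᵇ keep (List.tabulate g)) ≡
  ℚΣ.∑[ c < m ] (if keep (g c) then f (g c) else 0ℚ)
foldr-filterᵇ-tabulate {zero}  g keep f = refl
foldr-filterᵇ-tabulate {suc m} g keep f with keep (g zero)
... | true  = cong (f (g zero) ℚ.+_) (foldr-filterᵇ-tabulate (g ∘ suc) keep f)
... | false = trans (foldr-filterᵇ-tabulate (g ∘ suc) keep f) (sym (ℚ.+-identityˡ rest))
  where rest = ℚΣ.∑[ c < m ] (if keep (g (suc c)) then f (g (suc c)) else 0ℚ)

sumℚ≡∑ : ∀ {m} (keep : Fin m → Bool) (f : Fin m → ℚ) →
         sumℚ keep f ≡ ℚΣ.∑[ c < m ] (if keep c then f c else 0ℚ)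
sumℚ≡∑ keep f = foldr-filterᵇ-tabulate id keep f

module _ {n k m : ℕ} (p : Fin n → Fin k) (q : Fin n → Fin m) (X : Subset k) where

  covered : Fin m → ℕ
  covered c = ∣ U p X ∩ block q c ∣

  size : Fin m → ℕ
  size c = ∣ block q c ∣

  covered≤size : ∀ c → covered c ≤ size c
  covered≤size c = ∣p∩q∣≤∣q∣ (U p X) (block q c)

  misplacedIn : Subset m → Fin m → ℕ
  misplacedIn T' c = misplaced (lookup T' c) (covered c) (size c)

  lookup-S'-of : ∀ i j c → lookup (S'-of p q i j X) c ≡
                 (⌊ c ≟ i ⌋ ∨ ((not ⌊ c ≟ i ⌋ ∧ not ⌊ c ≟ j ⌋) ∧ (suc (size c) ≤ᵇ 2 * covered c)))
  lookup-S'-of i j c = lookup∘tabulate _ c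

  S'-of-minimal : ∀ {i j} (T' : Subset m) → lookup T' i ≡ true → lookup T' j ≡ false →
                  ∀ c → misplacedIn (S'-of p q i j X) c ≤ misplacedIn T' c
  S'-of-minimal {i} {j} T' T'i T'j c rewrite lookup-S'-of i j c with c ≟ i | c ≟ j
  ... | yes refl | _        rewrite T'i = ≤-refl
  ... | no _     | yes refl rewrite T'j = ≤-refl
  ... | no _     | no _     = misplaced-by-majority-≤ (lookup T' c) _ _

  cost-S'-of-minimal : ∀ {i j} (T' : Subset m) → lookup T' i ≡ true → lookup T' j ≡ false →
                       ∣ U p X △ U q (S'-of p q i j X) ∣ ≤ ∣ U p X △ U q T' ∣
  cost-S'-of-minimal {i} {j} T' T'i T'j = subst₂ _≤_
    (sym (∣A△U∣≡∑misplaced q (U p X) (S'-of p q i j X))) (sym (∣A△U∣≡∑misplaced q (U p X) T'))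
    (∑-mono-≤ (S'-of-minimal T' T'i T'j))

  module _ {i j : Fin m} (i≢j : i ≢ j) where

    peakTerm jTerm iTerm restTerm : Fin m → ℚ
    peakTerm c = ℕ→ℚ (size c) ℚ.* peak (ratio (covered c) (size c))
    jTerm c    = if ⌊ c ≟ j ⌋ then ℕ→ℚ (covered j) else 0ℚ
    iTerm c    = if ⌊ c ≟ i ⌋ then ℕ→ℚ (size i) ℚ.- ℕ→ℚ (covered i) else 0ℚ
    restTerm c = if notIJ i j c then peakTerm c else 0ℚ

    ℕ→ℚ-misplacedIn-S'-of : ∀ c → ℕ→ℚ (misplacedIn (S'-of p q i j X) c) ≡ jTerm c ℚ.+ iTerm c ℚ.+ restTerm c
    ℕ→ℚ-misplacedIn-S'-of c =
      trans (cong (λ t → ℕ→ℚ (misplaced t (covered c) (size c))) (lookup-S'-of i j c)) (by-cases (c ≟ i) (c ≟ j))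
      where
      by-cases : (c≟i : Dec (c ≡ i)) (c≟j : Dec (c ≡ j)) →
        ℕ→ℚ (misplaced (⌊ c≟i ⌋ ∨ ((not ⌊ c≟i ⌋ ∧ not ⌊ c≟j ⌋) ∧ (suc (size c) ≤ᵇ 2 * covered c))) (covered c) (size c))
        ≡ (if ⌊ c≟j ⌋ then ℕ→ℚ (covered j) else 0ℚ)
          ℚ.+ (if ⌊ c≟i ⌋ then ℕ→ℚ (size i) ℚ.- ℕ→ℚ (covered i) else 0ℚ)
          ℚ.+ (if not ⌊ c≟i ⌋ ∧ not ⌊ c≟j ⌋ then peakTerm c else 0ℚ)
      by-cases (yes refl) (yes i≡j) = ⊥-elim (i≢j i≡j)
      by-cases (yes refl) (no _)    =
        trans (ℕ→ℚ-∸ (covered≤size i)) (sym (trans (ℚ.+-identityʳ (0ℚ ℚ.+ x)) (ℚ.+-identityˡ x)))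
        where x = ℕ→ℚ (size i) ℚ.- ℕ→ℚ (covered i)
      by-cases (no _)     (yes refl) = sym (trans (ℚ.+-identityʳ (x ℚ.+ 0ℚ)) (ℚ.+-identityʳ x))
        where x = ℕ→ℚ (covered j)
      by-cases (no _)     (no _)     = trans (sym (peak-scaled (covered≤size c)))
        (sym (trans (cong (ℚ._+ peakTerm c) (ℚ.+-identityˡ 0ℚ)) (ℚ.+-identityˡ (peakTerm c))))

    ℕ→ℚ-cost-S'-of : ℕ→ℚ ∣ U p X △ U q (S'-of p q i j X) ∣ ≡ phi* p q i j X
    ℕ→ℚ-cost-S'-of = begin
      ℕ→ℚ ∣ U p X △ U q S' ∣                         ≡⟨ cong ℕ→ℚ (∣A△U∣≡∑misplaced q (U p X) S') ⟩
      ℕ→ℚ (ℕΣ.∑[ c < m ] misplacedIn S' c)           ≡⟨ ℕ→ℚ-∑ (misplacedIn S') ⟩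
      ℚΣ.∑[ c < m ] ℕ→ℚ (misplacedIn S' c)           ≡⟨ ℚΣ.sum-cong-≗ {m} ℕ→ℚ-misplacedIn-S'-of ⟩
      ℚΣ.∑[ c < m ] (jTerm c ℚ.+ iTerm c ℚ.+ restTerm c)
                                                     ≡⟨ ℚΣ.∑-distrib-+ (λ c → jTerm c ℚ.+ iTerm c) restTerm ⟩
      ℚΣ.∑[ c < m ] (jTerm c ℚ.+ iTerm c) ℚ.+ ∑rest  ≡⟨ cong (ℚ._+ ∑rest) (ℚΣ.∑-distrib-+ jTerm iTerm) ⟩
      ℚΣ.sum jTerm ℚ.+ ℚΣ.sum iTerm ℚ.+ ∑rest        ≡⟨ cong₂ (λ x y → x ℚ.+ y ℚ.+ ∑rest)
                                                          (∑-indicator ℚ.+-0-monoid j (ℕ→ℚ (covered j)))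
                                                          (∑-indicator ℚ.+-0-monoid i (ℕ→ℚ (size i) ℚ.- ℕ→ℚ (covered i))) ⟩
      ℕ→ℚ (covered j) ℚ.+ (ℕ→ℚ (size i) ℚ.- ℕ→ℚ (covered i)) ℚ.+ ∑rest
                                                     ≡⟨ cong (ℕ→ℚ (covered j) ℚ.+ (ℕ→ℚ (size i) ℚ.- ℕ→ℚ (covered i)) ℚ.+_)
                                                          (sumℚ≡∑ (notIJ i j) peakTerm) ⟨
      phi* p q i j X                                 ∎
      where open ≡-Reasoning; S' = S'-of p q i j X; ∑rest = ℚΣ.sum restTerm

proposition9 : (n k m : ℕ) (p : Fin n → Fin k) (q : Fin n → Fin m) →
    Surjective p → Surjective q → 2 ≤ k →
    (i j : Fin m) → i ≢ j →
    (S : Subset k) → Nonempty S → Nonempty (∁ S) →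
    ((T : Subset k) → Nonempty T → Nonempty (∁ T) →
       phi* p q i j S ≤ℚ phi* p q i j T) →
    (T : Subset k) → Nonempty T → Nonempty (∁ T) →
    (T' : Subset m) → lookup T' i ≡ true → lookup T' j ≡ false →
    ∣ U p S △ U q (S'-of p q i j S) ∣ ≤ ∣ U p T △ U q T' ∣
proposition9 n k m p q _ _ _ i j i≢j S _ _ S-minimises T T≢∅ ∁T≢∅ T' T'i T'j = begin
  ∣ U p S △ U q (S'-of p q i j S) ∣   ≤⟨ ℕ→ℚ-cancel-≤ (subst₂ _≤ℚ_ (sym (ℕ→ℚ-cost-S'-of p q S i≢j))
                                                                  (sym (ℕ→ℚ-cost-S'-of p q T i≢j))
                                                                  (S-minimises T T≢∅ ∁T≢∅)) ⟩
  ∣ U p T △ U q (S'-of p q i j T) ∣   ≤⟨ cost-S'-of-minimal p q T T' T'i T'j ⟩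
  ∣ U p T △ U q T' ∣                   ∎
  where open ℕ.≤-Reasoning
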